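{- Let $S$ be a finite set of positive integers and let $\{a_i,b_i,d_i: i\in S\}$ be real numbers with $a_i+b_i\ne 0$ for all $i\in S$. Then $$\sum_{\emptyset\ne I\subseteq S}\left(\sum_{i\in S\setminus I}d_i\right)\left(\prod_{j\in I}a_j\right)\left(\prod_{r\in S\setminus I}b_r\right)=\left(\prod_{j\in S}(a_j+b_j)\right)\left(\sum_{i\in S}\frac{d_ib_i}{a_i+b_i}\right)-\left(\prod_{r\in S}b_r\right)\left(\sum_{i\in S}d_i\right).$$
   Context: An empty product equals $1$ and an empty sum equals $0$. -}

module Defs where

open import Level using (Level; _⊔_) renaming (suc to lsuc)
open import Data.Nat using (ℕ; zero; suc)
open import Data.Fin using (Fin; zero; suc)
open import Data.Bool using (if_then_else_)
open import Data.List using (List; []; _∷_; _++_; map; filter; foldr)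
open import Data.Vec using ([]; _∷_; lookup)
open import Data.Fin.Subset using (Subset; inside; outside; ∁)
open import Data.Fin.Subset.Properties using (nonempty?)
open import Relation.Nullary using (¬_)
open import Algebra.Bundles using (CommutativeRing)

record Field (c ℓ : Level) : Set (lsuc (c ⊔ ℓ)) where
  field
    commutativeRing : CommutativeRing c ℓ
  open CommutativeRing commutativeRing public
  field
    inv      : (x : Carrier) → ¬ (x ≈ 0#) → Carrier
    inverse  : (x : Carrier) (p : ¬ (x ≈ 0#)) → x * inv x p ≈ 1#
    0≉1      : ¬ (0# ≈ 1#)

  div : (x y : Carrier) → ¬ (y ≈ 0#) → Carrier
  div x y p = x * inv y p

allSubsets : (n : ℕ) → List (Subset n)
allSubsets zero    = [] ∷ []
allSubsets (suc n) = map (outside ∷_) (allSubsets n) ++ map (inside ∷_) (allSubsets n)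

nonemptySubsets : (n : ℕ) → List (Subset n)
nonemptySubsets n = filter nonempty? (allSubsets n)

module FieldSums {c ℓ} (F : Field c ℓ) where
  open Field F hiding (zero)

  sumFin : {n : ℕ} → (Fin n → Carrier) → Carrier
  sumFin {zero}  f = 0#
  sumFin {suc n} f = f zero + sumFin (λ i → f (suc i))

  prodFin : {n : ℕ} → (Fin n → Carrier) → Carrier
  prodFin {zero}  f = 1#
  prodFin {suc n} f = f zero * prodFin (λ i → f (suc i))

  sumOver : {n : ℕ} → Subset n → (Fin n → Carrier) → Carrier
  sumOver I f = sumFin (λ i → if lookup I i then f i else 0#)

  prodOver : {n : ℕ} → Subset n → (Fin n → Carrier) → Carrier
  prodOver I f = prodFin (λ i → if lookup I i then f i else 1#)

  sumList : {n : ℕ} → List (Subset n) → (Subset n → Carrier) → Carrier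
  sumList Is g = foldr (λ I acc → g I + acc) 0# Is

  sumNonemptySubsets : {n : ℕ} → (Subset n → Carrier) → Carrier
  sumNonemptySubsets {n} g = sumList (nonemptySubsets n) g

-- The term for I = ∅ is ∏ b · Σ d, so it suffices to show that the sum over
-- all subsets, T_n = Σ_I (Σ_{i∉I} d_i) ∏_I a ∏_{∁I} b, equals
-- ∏ (a_j + b_j) · Σ d_i b_i / (a_i + b_i).  Splitting on whether the first
-- index lies in I gives T_{n+1} = d₀ b₀ W_n + (a₀ + b₀) T_n, where
-- W_n = Σ_I ∏_I a ∏_{∁I} b = ∏ (a_j + b_j) is the binomial expansion, and the
-- right-hand side satisfies the same recursion since
-- (a₀ + b₀) · d₀ b₀ / (a₀ + b₀) = d₀ b₀.
module Submission where

open import Defs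
open import Data.Bool using (true; false)
open import Data.Nat using (ℕ; zero; suc)
open import Data.Fin using (Fin; zero; suc)
open import Data.Fin.Subset using (Subset; inside; outside; ⊥; ∁; Nonempty)
open import Data.Fin.Subset.Properties using (nonempty?)
open import Data.List using (List; []; _∷_; _++_; map; filter)
open import Data.List.Properties using (filter-++; filter-all; filter-reject; filter-≐)
open import Data.List.Relation.Unary.All using (universal)
open import Data.Vec using ([]; _∷_; here; there)
open import Data.Product using (_,_)
open import Function using (_∘_)
open import Relation.Nullary using (¬_; does)
open import Relation.Unary using (Pred; Decidable)
import Relation.Binary.PropositionalEquality as ≡
open ≡ using (_≡_; cong; cong₂)
open import Relation.Binary.PropositionalEquality.Properties using (module ≡-Reasoning)

filter-map : ∀ {a b p} {A : Set a} {B : Set b} {P : Pred B p} (P? : Decidable P)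
             (f : A → B) (xs : List A) →
             filter P? (map f xs) ≡ map f (filter (P? ∘ f) xs)
filter-map P? f []       = ≡.refl
filter-map P? f (x ∷ xs) with does (P? (f x))
... | true  = cong (f x ∷_) (filter-map P? f xs)
... | false = filter-map P? f xs

nonempty-outside⇒nonempty : ∀ {n} {p : Subset n} → Nonempty (outside ∷ p) → Nonempty p
nonempty-outside⇒nonempty (suc i , there i∈p) = i , i∈p

nonempty⇒nonempty-outside : ∀ {n} {p : Subset n} → Nonempty p → Nonempty (outside ∷ p)
nonempty⇒nonempty-outside (i , i∈p) = suc i , there i∈p

nonempty-inside : ∀ {n} (p : Subset n) → Nonempty (inside ∷ p)
nonempty-inside p = zero , here

nonemptySubsets-zero : nonemptySubsets zero ≡ []
nonemptySubsets-zero = filter-reject nonempty? {x = []} {xs = []} λ { (() , _) }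

nonemptySubsets-suc : ∀ n → nonemptySubsets (suc n) ≡
                      map (outside ∷_) (nonemptySubsets n) ++ map (inside ∷_) (allSubsets n)
nonemptySubsets-suc n = begin
  filter nonempty? (map (outside ∷_) A ++ map (inside ∷_) A)
    ≡⟨ filter-++ nonempty? (map (outside ∷_) A) (map (inside ∷_) A) ⟩
  filter nonempty? (map (outside ∷_) A) ++ filter nonempty? (map (inside ∷_) A)
    ≡⟨ cong₂ _++_ (filter-map nonempty? (outside ∷_) A) (filter-map nonempty? (inside ∷_) A) ⟩
  map (outside ∷_) (filter (nonempty? ∘ (outside ∷_)) A) ++ map (inside ∷_) (filter (nonempty? ∘ (inside ∷_)) A)
    ≡⟨ cong₂ (λ X Y → map (outside ∷_) X ++ map (inside ∷_) Y)
             (filter-≐ (nonempty? ∘ (outside ∷_)) nonempty?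
                       (nonempty-outside⇒nonempty , nonempty⇒nonempty-outside) A)
             (filter-all (nonempty? ∘ (inside ∷_)) (universal nonempty-inside A)) ⟩
  map (outside ∷_) (nonemptySubsets n) ++ map (inside ∷_) A ∎
  where
  open ≡-Reasoning
  A = allSubsets n

module SubsetSums {c ℓ} (F : Field c ℓ) where
  open Field F hiding (zero)
  open FieldSums F
  open import Algebra.Properties.CommutativeSemigroup +-commutativeSemigroup using (interchange; xy∙z≈xz∙y)
  open import Algebra.Properties.CommutativeSemigroup *-commutativeSemigroup using (x∙yz≈y∙xz)
  open import Algebra.Solver.Ring.NaturalCoefficients.Default commutativeSemiring
  open import Relation.Binary.Reasoning.Setoid setoid

  sumList-cong : ∀ {n} (L : List (Subset n)) {f g : Subset n → Carrier} →
                 (∀ I → f I ≈ g I) → sumList L f ≈ sumList L g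
  sumList-cong []      f≈g = refl
  sumList-cong (I ∷ L) f≈g = +-cong (f≈g I) (sumList-cong L f≈g)

  sumList-map : ∀ {m n} (h : Subset m → Subset n) (L : List (Subset m)) (g : Subset n → Carrier) →
                sumList (map h L) g ≈ sumList L (g ∘ h)
  sumList-map h []      g = refl
  sumList-map h (I ∷ L) g = +-congˡ (sumList-map h L g)

  sumList-++ : ∀ {n} (L₁ L₂ : List (Subset n)) (g : Subset n → Carrier) →
               sumList (L₁ ++ L₂) g ≈ sumList L₁ g + sumList L₂ g
  sumList-++ []       L₂ g = sym (+-identityˡ _)
  sumList-++ (I ∷ L₁) L₂ g = trans (+-congˡ (sumList-++ L₁ L₂ g)) (sym (+-assoc _ _ _))

  sumList-+ : ∀ {n} (L : List (Subset n)) (f g : Subset n → Carrier) →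
              sumList L (λ I → f I + g I) ≈ sumList L f + sumList L g
  sumList-+ []      f g = sym (+-identityˡ _)
  sumList-+ (I ∷ L) f g = trans (+-congˡ (sumList-+ L f g)) (interchange (f I) (g I) _ _)

  sumList-*ˡ : ∀ {n} (L : List (Subset n)) (k : Carrier) (f : Subset n → Carrier) →
               sumList L (λ I → k * f I) ≈ k * sumList L f
  sumList-*ˡ []      k f = sym (zeroʳ k)
  sumList-*ˡ (I ∷ L) k f = trans (+-congˡ (sumList-*ˡ L k f)) (sym (distribˡ k _ _))

  sumList-extend : ∀ {n} (L₁ L₂ : List (Subset n)) (g : Subset (suc n) → Carrier) →
                   sumList (map (outside ∷_) L₁ ++ map (inside ∷_) L₂) g
                   ≈ sumList L₁ (g ∘ (outside ∷_)) + sumList L₂ (g ∘ (inside ∷_))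
  sumList-extend L₁ L₂ g = trans (sumList-++ (map (outside ∷_) L₁) (map (inside ∷_) L₂) g)
                                 (+-cong (sumList-map (outside ∷_) L₁ g) (sumList-map (inside ∷_) L₂ g))

  sumNonemptySubsets+⊥ : ∀ n (g : Subset n → Carrier) →
                         sumNonemptySubsets g + g ⊥ ≈ sumList (allSubsets n) g
  sumNonemptySubsets+⊥ zero g rewrite nonemptySubsets-zero = trans (+-identityˡ _) (sym (+-identityʳ _))
  sumNonemptySubsets+⊥ (suc n) g = begin
    sumList (nonemptySubsets (suc n)) g + g ⊥
      ≡⟨ cong (λ L → sumList L g + g ⊥) (nonemptySubsets-suc n) ⟩
    sumList (map (outside ∷_) (nonemptySubsets n) ++ map (inside ∷_) (allSubsets n)) g + g ⊥
      ≈⟨ +-congʳ (sumList-extend (nonemptySubsets n) (allSubsets n) g) ⟩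
    (sumNonemptySubsets (g ∘ (outside ∷_)) + rest) + g ⊥
      ≈⟨ xy∙z≈xz∙y _ rest _ ⟩
    (sumNonemptySubsets (g ∘ (outside ∷_)) + g ⊥) + rest
      ≈⟨ +-congʳ (sumNonemptySubsets+⊥ n (g ∘ (outside ∷_))) ⟩
    sumList (allSubsets n) (g ∘ (outside ∷_)) + rest
      ≈⟨ sumList-extend (allSubsets n) (allSubsets n) g ⟨
    sumList (allSubsets (suc n)) g ∎
    where rest = sumList (allSubsets n) (g ∘ (inside ∷_))

  weight : ∀ {n} (a b : Fin n → Carrier) → Subset n → Carrier
  weight a b I = prodOver I a * prodOver (∁ I) b

  summand : ∀ {n} (a b d : Fin n → Carrier) → Subset n → Carrier
  summand a b d I = (sumOver (∁ I) d * prodOver I a) * prodOver (∁ I) b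

  module _ {n} (a b : Fin (suc n) → Carrier) (I : Subset n) where
    weight-outside : weight a b (outside ∷ I) ≈ b zero * weight (a ∘ suc) (b ∘ suc) I
    weight-outside = solve 3 (λ b₀ p q → (con 1 :* p) :* (b₀ :* q) := b₀ :* (p :* q)) refl
                       (b zero) (prodOver I (a ∘ suc)) (prodOver (∁ I) (b ∘ suc))

    weight-inside : weight a b (inside ∷ I) ≈ a zero * weight (a ∘ suc) (b ∘ suc) I
    weight-inside = solve 3 (λ a₀ p q → (a₀ :* p) :* (con 1 :* q) := a₀ :* (p :* q)) refl
                      (a zero) (prodOver I (a ∘ suc)) (prodOver (∁ I) (b ∘ suc))

  module _ {n} (a b d : Fin (suc n) → Carrier) (I : Subset n) where
    private
      a′ = a ∘ suc
      b′ = b ∘ suc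
      d′ = d ∘ suc

    summand-outside : summand a b d (outside ∷ I)
                      ≈ (d zero * b zero) * weight a′ b′ I + b zero * summand a′ b′ d′ I
    summand-outside = solve 5 (λ d₀ b₀ s p q → ((d₀ :+ s) :* (con 1 :* p)) :* (b₀ :* q)
                                               := (d₀ :* b₀) :* (p :* q) :+ b₀ :* ((s :* p) :* q)) refl
                        (d zero) (b zero) (sumOver (∁ I) d′) (prodOver I a′) (prodOver (∁ I) b′)

    summand-inside : summand a b d (inside ∷ I) ≈ a zero * summand a′ b′ d′ I
    summand-inside = solve 4 (λ a₀ s p q → ((con 0 :+ s) :* (a₀ :* p)) :* (con 1 :* q)
                                           := a₀ :* ((s :* p) :* q)) refl
                       (a zero) (sumOver (∁ I) d′) (prodOver I a′) (prodOver (∁ I) b′)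

  sumList-weight : ∀ n (a b : Fin n → Carrier) →
                   sumList (allSubsets n) (weight a b) ≈ prodFin (λ j → a j + b j)
  sumList-weight zero    a b = trans (+-identityʳ _) (*-identityˡ _)
  sumList-weight (suc n) a b = begin
    sumList (allSubsets (suc n)) (weight a b)
      ≈⟨ sumList-extend A A (weight a b) ⟩
    sumList A (weight a b ∘ (outside ∷_)) + sumList A (weight a b ∘ (inside ∷_))
      ≈⟨ +-cong (sumList-cong A (weight-outside a b)) (sumList-cong A (weight-inside a b)) ⟩
    sumList A (λ I → b zero * weight a′ b′ I) + sumList A (λ I → a zero * weight a′ b′ I)
      ≈⟨ +-cong (sumList-*ˡ A (b zero) (weight a′ b′)) (sumList-*ˡ A (a zero) (weight a′ b′)) ⟩
    b zero * W + a zero * W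
      ≈⟨ trans (+-comm _ _) (sym (distribʳ W (a zero) (b zero))) ⟩
    (a zero + b zero) * W
      ≈⟨ *-congˡ (sumList-weight n a′ b′) ⟩
    (a zero + b zero) * prodFin (λ j → a′ j + b′ j) ∎
    where
    A = allSubsets n
    a′ = a ∘ suc
    b′ = b ∘ suc
    W = sumList A (weight a′ b′)

  sumList-summand-suc : ∀ n (a b d : Fin (suc n) → Carrier) →
    sumList (allSubsets (suc n)) (summand a b d)
    ≈ (d zero * b zero) * sumList (allSubsets n) (weight (a ∘ suc) (b ∘ suc))
      + (a zero + b zero) * sumList (allSubsets n) (summand (a ∘ suc) (b ∘ suc) (d ∘ suc))
  sumList-summand-suc n a b d = begin
    sumList (allSubsets (suc n)) (summand a b d)
      ≈⟨ sumList-extend A A (summand a b d) ⟩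
    sumList A (summand a b d ∘ (outside ∷_)) + sumList A (summand a b d ∘ (inside ∷_))
      ≈⟨ +-cong (sumList-cong A (summand-outside a b d)) (sumList-cong A (summand-inside a b d)) ⟩
    sumList A (λ I → (d zero * b zero) * weight a′ b′ I + b zero * summand a′ b′ d′ I)
      + sumList A (λ I → a zero * summand a′ b′ d′ I)
      ≈⟨ +-congʳ (sumList-+ A _ _) ⟩
    (sumList A (λ I → (d zero * b zero) * weight a′ b′ I) + sumList A (λ I → b zero * summand a′ b′ d′ I))
      + sumList A (λ I → a zero * summand a′ b′ d′ I)
      ≈⟨ +-cong (+-cong (sumList-*ˡ A _ _) (sumList-*ˡ A _ _)) (sumList-*ˡ A _ _) ⟩
    ((d zero * b zero) * W + b zero * T) + a zero * T
      ≈⟨ +-assoc _ _ _ ⟩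
    (d zero * b zero) * W + (b zero * T + a zero * T)
      ≈⟨ +-congˡ (trans (+-comm _ _) (sym (distribʳ T (a zero) (b zero)))) ⟩
    (d zero * b zero) * W + (a zero + b zero) * T ∎
    where
    A = allSubsets n
    a′ = a ∘ suc
    b′ = b ∘ suc
    d′ = d ∘ suc
    W = sumList A (weight a′ b′)
    T = sumList A (summand a′ b′ d′)

  *-div-cancel : ∀ x y (y≉0 : ¬ (y ≈ 0#)) → y * div x y y≉0 ≈ x
  *-div-cancel x y y≉0 = begin
    y * (x * inv y y≉0) ≈⟨ x∙yz≈y∙xz y x _ ⟩
    x * (y * inv y y≉0) ≈⟨ *-congˡ (inverse y y≉0) ⟩
    x * 1#              ≈⟨ *-identityʳ x ⟩
    x                   ∎

  sumList-summand : ∀ n (a b d : Fin n → Carrier) (nz : (i : Fin n) → ¬ (a i + b i ≈ 0#)) →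
                    sumList (allSubsets n) (summand a b d)
                    ≈ prodFin (λ j → a j + b j) * sumFin (λ i → div (d i * b i) (a i + b i) (nz i))
  sumList-summand zero    a b d nz = solve 0 ((con 0 :* con 1) :* con 1 :+ con 0 := con 1 :* con 0) refl
  sumList-summand (suc n) a b d nz = begin
    sumList (allSubsets (suc n)) (summand a b d)
      ≈⟨ sumList-summand-suc n a b d ⟩
    (d zero * b zero) * sumList (allSubsets n) (weight a′ b′)
      + (a zero + b zero) * sumList (allSubsets n) (summand a′ b′ d′)
      ≈⟨ +-cong (*-congˡ (sumList-weight n a′ b′)) (*-congˡ (sumList-summand n a′ b′ d′ (nz ∘ suc))) ⟩
    (d zero * b zero) * P + s * (P * Q)
      ≈⟨ +-congʳ (*-congʳ (*-div-cancel (d zero * b zero) s (nz zero))) ⟨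
    (s * q₀) * P + s * (P * Q)
      ≈⟨ solve 4 (λ s q₀ P Q → (s :* q₀) :* P :+ s :* (P :* Q) := (s :* P) :* (q₀ :+ Q)) refl s q₀ P Q ⟩
    (s * P) * (q₀ + Q) ∎
    where
    a′ = a ∘ suc
    b′ = b ∘ suc
    d′ = d ∘ suc
    s = a zero + b zero
    q₀ = div (d zero * b zero) s (nz zero)
    P = prodFin (λ j → a′ j + b′ j)
    Q = sumFin (λ i → div (d′ i * b′ i) (a′ i + b′ i) (nz (suc i)))

  sumOver-∁⊥ : ∀ {n} (f : Fin n → Carrier) → sumOver (∁ ⊥) f ≈ sumFin f
  sumOver-∁⊥ {zero}  f = refl
  sumOver-∁⊥ {suc n} f = +-congˡ (sumOver-∁⊥ (f ∘ suc))

  prodOver-∁⊥ : ∀ {n} (f : Fin n → Carrier) → prodOver (∁ ⊥) f ≈ prodFin f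
  prodOver-∁⊥ {zero}  f = refl
  prodOver-∁⊥ {suc n} f = *-congˡ (prodOver-∁⊥ (f ∘ suc))

  prodOver-⊥ : ∀ {n} (f : Fin n → Carrier) → prodOver ⊥ f ≈ 1#
  prodOver-⊥ {zero}  f = refl
  prodOver-⊥ {suc n} f = trans (*-identityˡ _) (prodOver-⊥ (f ∘ suc))

  summand-⊥ : ∀ {n} (a b d : Fin n → Carrier) → summand a b d ⊥ ≈ prodFin b * sumFin d
  summand-⊥ a b d = begin
    (sumOver (∁ ⊥) d * prodOver ⊥ a) * prodOver (∁ ⊥) b
      ≈⟨ *-cong (*-cong (sumOver-∁⊥ d) (prodOver-⊥ a)) (prodOver-∁⊥ b) ⟩
    (sumFin d * 1#) * prodFin b
      ≈⟨ trans (*-congʳ (*-identityʳ _)) (*-comm _ _) ⟩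
    prodFin b * sumFin d ∎

lemma2p4 : ∀ {c ℓ} (F : Field c ℓ) (n : ℕ) (a b d : Fin n → Field.Carrier F)
           (nz : (i : Fin n) → ¬ (Field._≈_ F (Field._+_ F (a i) (b i)) (Field.0# F))) →
           let open Field F in
           let open FieldSums F in
           sumNonemptySubsets (λ I → (sumOver (∁ I) d * prodOver I a) * prodOver (∁ I) b)
           ≈ prodFin (λ j → a j + b j) * sumFin (λ i → div (d i * b i) (a i + b i) (nz i))
             - prodFin b * sumFin d
lemma2p4 F n a b d nz = begin
  S
    ≈⟨ //-rightDividesʳ E S ⟨
  (S + E) - E
    ≈⟨ +-cong (sumNonemptySubsets+⊥ n (summand a b d)) (-‿cong (summand-⊥ a b d)) ⟩
  sumList (allSubsets n) (summand a b d) - prodFin b * sumFin d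
    ≈⟨ +-congʳ (sumList-summand n a b d nz) ⟩
  prodFin (λ j → a j + b j) * sumFin (λ i → div (d i * b i) (a i + b i) (nz i)) - prodFin b * sumFin d ∎
  where
  open Field F
  open FieldSums F
  open SubsetSums F
  open import Algebra.Properties.Group +-group using (//-rightDividesʳ)
  open import Relation.Binary.Reasoning.Setoid setoid
  S = sumNonemptySubsets (summand a b d)
  E = summand a b d ⊥
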